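{- Let $\mathcal{S}$ be the Spitzer Hopf algebra described in the context. Its antipode $S$ satisfies, for every $n\ge1$, $$S\big((\rho X)^{[n]}\big)=-\rho\big(X(\tilde\rho X)^{\{n-1\}}\big),$$ where $\tilde\rho:=-\mathrm{id}-\rho$, $(\tilde\rho X)^{\{0\}}=1$ and $(\tilde\rho X)^{\{m+1\}}=\tilde\rho\big(X(\tilde\rho X)^{\{m\}}\big)$.
   Context: $\mathbb{K}$ is a field of characteristic zero; $T(X)$ is the free associative unital $\mathbb{K}$-algebra on countably many noncommuting variables $x_1,x_2,\dots$; $\mathcal{A}$ is the unital algebra of sequences $(y_1,y_2,\dots)$ of elements of $T(X)$ with componentwise operations (unit $1=(1,1,\dots)$); $\rho(y_1,y_2,\dots)=(0,y_1,y_1+y_2,y_1+y_2+y_3,\dots)$, a weight-$1$ Rota–Baxter operator; $X=(x_1,x_2,\dots)\in\mathcal{A}$. Set $(\rho X)^{[0]}=1$, $(\rho X)^{[n+1]}=\rho\big((\rho X)^{[n]}X\big)$. The Spitzer algebra $\mathcal{S}$ is the unital subalgebra of $\mathcal{A}$ generated by the $(\rho X)^{[n]}$, $n\ge1$ (they generate it freely), made into a graded connected cocommutative Hopf algebra by declaring $(\rho X)^{[n]}$ of degree $n$ and $\Delta\big((\rho X)^{[n]}\big)=\sum_{m=0}^{n}(\rho X)^{[m]}\otimes(\rho X)^{[n-m]}$. -}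

module Defs where

open import Level using (Level; _⊔_)
open import Algebra.Bundles using (CommutativeRing)
open import Data.Nat as ℕ using (ℕ; zero; suc)
open import Data.List using (List; []; _∷_; _++_; map; concatMap; foldr)
open import Data.List.Properties using (≡-dec)
open import Data.Nat.Properties using () renaming (_≟_ to _≟ℕ_)
open import Data.Product using (_×_; _,_; Σ; proj₁; proj₂)
open import Relation.Nullary using (¬_; yes; no)
open import Relation.Binary.PropositionalEquality using (_≡_)

natMul : {c ℓ : Level} (R : CommutativeRing c ℓ) → ℕ → CommutativeRing.Carrier R
natMul R zero    = CommutativeRing.0# R
natMul R (suc n) = CommutativeRing._+_ R (CommutativeRing.1# R) (natMul R n)

record CharZeroField (c ℓ : Level) : Set (Level.suc (c ⊔ ℓ)) where
  field
    commutativeRing : CommutativeRing c ℓ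
  open CommutativeRing commutativeRing
  field
    0≉1       : ¬ (0# ≈ 1#)
    inverse   : ∀ x → ¬ (x ≈ 0#) → Σ Carrier (λ y → x * y ≈ 1#)
    charZero  : ∀ n → ¬ (natMul commutativeRing (suc n) ≈ 0#)

module Spitzer {c ℓ : Level} (R : CommutativeRing c ℓ) where
  open CommutativeRing R using (_≈_; _+_; _*_; -_; 0#; 1#) renaming (Carrier to K)

  Word : Set
  Word = List ℕ

  -- an element of T(X): a finite formal K-linear combination of words
  T : Set c
  T = List (K × Word)

  coeff : T → Word → K
  coeff []            w = 0#
  coeff ((a , u) ∷ p) w with ≡-dec _≟ℕ_ u w
  ... | yes _ = a + coeff p w
  ... | no  _ = coeff p w

  -- equality in T(X) (the free algebra is the quotient by this relation)
  _≈T_ : T → T → Set ℓ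
  p ≈T q = ∀ w → coeff p w ≈ coeff q w

  0T : T
  0T = []

  1T : T
  1T = (1# , []) ∷ []

  var : ℕ → T
  var i = (1# , i ∷ []) ∷ []

  _+T_ : T → T → T
  p +T q = p ++ q

  -T_ : T → T
  -T p = map (λ { (a , u) → (- a , u) }) p

  _*T_ : T → T → T
  p *T q = concatMap (λ { (a , u) → map (λ { (b , v) → (a * b , u ++ v) }) q }) p

  A : Set c
  A = ℕ → T

  _≈A_ : A → A → Set ℓ
  y ≈A z = ∀ k → y k ≈T z k

  0A : A
  0A k = 0T

  1A : A
  1A k = 1T

  _+A_ : A → A → A
  (y +A z) k = y k +T z k

  -A_ : A → A
  (-A y) k = -T (y k)

  _*A_ : A → A → A
  (y *A z) k = y k *T z k

  partialSum : A → ℕ → T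
  partialSum y zero    = 0T
  partialSum y (suc k) = partialSum y k +T y k

  ρ : A → A
  ρ y k = partialSum y k

  𝕏 : A
  𝕏 k = var k

  ρXpow : ℕ → A
  ρXpow zero = 1A
  ρXpow (suc n) = ρ (ρXpow n *A 𝕏)

  ρ̃ : A → A
  ρ̃ y = (-A y) +A (-A (ρ y))

  ρ̃Xpow : ℕ → A
  ρ̃Xpow zero = 1A
  ρ̃Xpow (suc m) = ρ̃ (𝕏 *A ρ̃Xpow m)

  sumTo : ℕ → (ℕ → A) → A
  sumTo zero    f = f zero
  sumTo (suc n) f = sumTo n f +A f (suc n)

  -- The antipode axioms  m∘(S⊗id)∘Δ = η∘ε = m∘(id⊗S)∘Δ  evaluated on the
  -- generators (ρX)^[n], with Δ((ρX)^[n]) = Σ_m (ρX)^[m] ⊗ (ρX)^[n-m],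
  -- ε((ρX)^[0]) = 1 and ε((ρX)^[n]) = 0 for n ≥ 1.  Here s n stands for
  -- S((ρX)^[n]) ∈ 𝒮 ⊆ 𝒜.
  record IsAntipodeOnGenerators (s : ℕ → A) : Set (c ⊔ ℓ) where
    field
      unit  : s zero ≈A 1A
      left  : ∀ n → sumTo (suc n) (λ m → s m *A ρXpow (suc n ℕ.∸ m)) ≈A 0A
      right : ∀ n → sumTo (suc n) (λ m → ρXpow m *A s (suc n ℕ.∸ m)) ≈A 0A

-- The antipode is the unique right convolution inverse of n ↦ (ρX)^[n], so it suffices to
-- check that t₀ = 1, tₙ₊₁ = -ρ(X(ρ̃X)^{n}) is one.  Since ρ̃ y = -(ρ y shifted by one index),
-- the components of both sequences satisfy recurrences linking index k + 1 to index k, under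
-- which the convolution Σₘ (ρX)^[m]ₖ t_{N-m,k} telescopes to the same value for every k; at
-- k = 0 it vanishes because ρ y has first component 0.
--
-- Computations in T(X) are carried out modulo p ≃ q, agreement under every evaluation
-- Σ a·u ↦ Σ a·f(u) with f : Word → K; this is a ring congruence by construction, and it
-- coincides with coefficientwise equality.
module Submission where

open import Algebra.Bundles using (Ring; CommutativeRing)
open import Data.Empty using (⊥-elim)
open import Data.List using ([]; _∷_; _++_; map; length)
open import Data.List.Properties using (≡-dec; ++-assoc; ++-identityʳ)
open import Data.Nat using (ℕ; zero; suc; _≤_; _∸_; z≤n; s≤s)
open import Data.Nat.Properties using (≤-refl; ≤-trans; m≤n⇒m≤1+n) renaming (_≟_ to _≟ℕ_)
open import Data.Product using (_×_; _,_)
open import Function using (_∘_)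
open import Level using (Level; _⊔_)
open import Relation.Binary.PropositionalEquality as ≡ using (_≡_)
open import Relation.Binary.Structures using (IsEquivalence)
open import Relation.Nullary using (yes; no)
import Algebra.Properties.CommutativeSemigroup as CommutativeSemigroupProperties
import Algebra.Properties.Ring as RingProperties
import Algebra.Solver.CommutativeMonoid as CommutativeMonoidSolver
import Relation.Binary.Reasoning.Setoid as SetoidReasoning

open import Defs

module Convolution {r ℓ} (R : Ring r ℓ) where
  open Ring R hiding (zero)
  open RingProperties R using (+-cancelʳ)
  open SetoidReasoning setoid
  open CommutativeMonoidSolver +-commutativeMonoid using (solve; _⊜_; _⊕_)

  conv : (ℕ → Carrier) → (ℕ → Carrier) → ℕ → Carrier
  conv a b zero    = a zero * b zero
  conv a b (suc N) = a zero * b (suc N) + conv (a ∘ suc) b N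

  conv-congʳ : ∀ a {b b′} N → (∀ j → j ≤ N → b j ≈ b′ j) → conv a b N ≈ conv a b′ N
  conv-congʳ a zero    b≈b′ = *-congˡ (b≈b′ zero ≤-refl)
  conv-congʳ a (suc N) b≈b′ =
    +-cong (*-congˡ (b≈b′ (suc N) ≤-refl))
           (conv-congʳ (a ∘ suc) N (λ j j≤N → b≈b′ j (m≤n⇒m≤1+n j≤N)))

  conv-zeroˡ : ∀ {a} b N → (∀ m → a m ≈ 0#) → conv a b N ≈ 0#
  conv-zeroˡ b zero    a≈0 = trans (*-congʳ (a≈0 zero)) (zeroˡ (b zero))
  conv-zeroˡ {a} b (suc N) a≈0 = begin
    a zero * b (suc N) + conv (a ∘ suc) b N ≈⟨ +-cong (*-congʳ (a≈0 zero)) (conv-zeroˡ b N (a≈0 ∘ suc)) ⟩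
    0# * b (suc N) + 0#                     ≈⟨ +-identityʳ _ ⟩
    0# * b (suc N)                          ≈⟨ zeroˡ _ ⟩
    0#                                      ∎

  -- With a′ = a + (d, a₀, a₁, …)·x and b = b′ + x·(0, b′₀, b′₁, …), moving the factor x from
  -- one sequence to the other shifts the index, leaving only the boundary term d·x·b′_N.
  conv-telescope : ∀ x {b b′} → b′ zero ≈ b zero → (∀ m → b′ (suc m) + x * b′ m ≈ b (suc m)) →
                   ∀ N a a′ d → a′ zero ≈ a zero + d * x → (∀ m → a′ (suc m) ≈ a (suc m) + a m * x) →
                   conv a′ b′ N ≈ conv a b N + d * x * b′ N
  conv-telescope x {b} {b′} b₀ bₛ zero a a′ d a′₀ a′ₛ = begin
    a′ zero * b′ zero                  ≈⟨ *-congʳ a′₀ ⟩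
    (a zero + d * x) * b′ zero         ≈⟨ distribʳ _ _ _ ⟩
    a zero * b′ zero + d * x * b′ zero ≈⟨ +-congʳ (*-congˡ b₀) ⟩
    a zero * b zero + d * x * b′ zero  ∎
  conv-telescope x {b} {b′} b₀ bₛ (suc N) a a′ d a′₀ a′ₛ = begin
    a′ zero * b′ (suc N) + conv (a′ ∘ suc) b′ N
      ≈⟨ +-cong (*-congʳ a′₀) (conv-telescope x b₀ bₛ N (a ∘ suc) (a′ ∘ suc) (a zero) (a′ₛ zero) (a′ₛ ∘ suc)) ⟩
    (a zero + d * x) * b′ (suc N) + (C + a zero * x * b′ N)
      ≈⟨ +-congʳ (distribʳ _ _ _) ⟩
    (a zero * b′ (suc N) + d * x * b′ (suc N)) + (C + a zero * x * b′ N)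
      ≈⟨ solve 4 (λ p q c r → (p ⊕ q) ⊕ (c ⊕ r) ⊜ ((p ⊕ r) ⊕ c) ⊕ q) refl
               (a zero * b′ (suc N)) (d * x * b′ (suc N)) C (a zero * x * b′ N) ⟩
    (a zero * b′ (suc N) + a zero * x * b′ N) + C + d * x * b′ (suc N)
      ≈⟨ +-congʳ (+-congʳ leading) ⟩
    a zero * b (suc N) + C + d * x * b′ (suc N)
      ∎
    where
    C : Carrier
    C = conv (a ∘ suc) b N
    leading : a zero * b′ (suc N) + a zero * x * b′ N ≈ a zero * b (suc N)
    leading = begin
      a zero * b′ (suc N) + a zero * x * b′ N   ≈⟨ +-congˡ (*-assoc _ _ _) ⟩
      a zero * b′ (suc N) + a zero * (x * b′ N) ≈⟨ distribˡ _ _ _ ⟨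
      a zero * (b′ (suc N) + x * b′ N)          ≈⟨ *-congˡ (bₛ N) ⟩
      a zero * b (suc N)                        ∎

  conv-rightInverse-unique : ∀ a {s s′} → a zero ≈ 1# → s zero ≈ s′ zero →
                        (∀ n → conv a s (suc n) ≈ 0#) → (∀ n → conv a s′ (suc n) ≈ 0#) →
                        ∀ n → s n ≈ s′ n
  conv-rightInverse-unique a {s} {s′} a₀≈1 s₀ inv inv′ n = agree n n ≤-refl
    where
    agree : ∀ N j → j ≤ N → s j ≈ s′ j
    agree N       zero    _         = s₀
    agree (suc N) (suc n) (s≤s n≤N) = begin
      s (suc n)                         ≈⟨ *-identityˡ _ ⟨
      1# * s (suc n)                    ≈⟨ *-congʳ a₀≈1 ⟨
      a zero * s (suc n)                ≈⟨ +-cancelʳ (conv (a ∘ suc) s′ n) _ _ leading-terms ⟩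
      a zero * s′ (suc n)               ≈⟨ *-congʳ a₀≈1 ⟩
      1# * s′ (suc n)                   ≈⟨ *-identityˡ _ ⟩
      s′ (suc n)                        ∎
      where
      leading-terms : a zero * s (suc n) + conv (a ∘ suc) s′ n ≈ a zero * s′ (suc n) + conv (a ∘ suc) s′ n
      leading-terms = begin
        a zero * s (suc n) + conv (a ∘ suc) s′ n
          ≈⟨ +-congˡ (conv-congʳ (a ∘ suc) n (λ j j≤n → agree N j (≤-trans j≤n n≤N))) ⟨
        conv a s (suc n)   ≈⟨ inv n ⟩
        0#                 ≈⟨ inv′ n ⟨
        conv a s′ (suc n)  ∎

module Evaluation {c ℓ} (R : CommutativeRing c ℓ) where
  open CommutativeRing R hiding (zero) renaming (Carrier to K)
  open RingProperties ring using (-‿distribˡ-*; -‿+-comm; -0#≈0#)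
  open CommutativeSemigroupProperties +-commutativeSemigroup using (interchange; x∙yz≈y∙xz)
  open SetoidReasoning setoid
  open Spitzer R

  ⟪_⟫ : T → (Word → K) → K
  ⟪ []          ⟫ f = 0#
  ⟪ (a , u) ∷ p ⟫ f = a * f u + ⟪ p ⟫ f

  infix 4 _≃_
  record _≃_ (p q : T) : Set (c ⊔ ℓ) where
    constructor mk≃
    field eval : ∀ f → ⟪ p ⟫ f ≈ ⟪ q ⟫ f
  open _≃_

  ⟪⟫-congʳ : ∀ p {f g} → (∀ u → f u ≈ g u) → ⟪ p ⟫ f ≈ ⟪ p ⟫ g
  ⟪⟫-congʳ []            f≈g = refl
  ⟪⟫-congʳ ((a , u) ∷ p) f≈g = +-cong (*-congˡ (f≈g u)) (⟪⟫-congʳ p f≈g)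

  ⟪⟫-+ʳ : ∀ p f g → ⟪ p ⟫ (λ u → f u + g u) ≈ ⟪ p ⟫ f + ⟪ p ⟫ g
  ⟪⟫-+ʳ []            f g = sym (+-identityʳ 0#)
  ⟪⟫-+ʳ ((a , u) ∷ p) f g = begin
    a * (f u + g u) + ⟪ p ⟫ (λ u → f u + g u) ≈⟨ +-cong (distribˡ a _ _) (⟪⟫-+ʳ p f g) ⟩
    (a * f u + a * g u) + (⟪ p ⟫ f + ⟪ p ⟫ g) ≈⟨ interchange _ _ _ _ ⟩
    (a * f u + ⟪ p ⟫ f) + (a * g u + ⟪ p ⟫ g) ∎

  ⟪+T⟫ : ∀ p q f → ⟪ p +T q ⟫ f ≈ ⟪ p ⟫ f + ⟪ q ⟫ f
  ⟪+T⟫ []            q f = sym (+-identityˡ _)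
  ⟪+T⟫ ((a , u) ∷ p) q f = trans (+-congˡ (⟪+T⟫ p q f)) (sym (+-assoc _ _ _))

  ⟪-T⟫ : ∀ p f → ⟪ -T p ⟫ f ≈ - ⟪ p ⟫ f
  ⟪-T⟫ []            f = sym -0#≈0#
  ⟪-T⟫ ((a , u) ∷ p) f = begin
    - a * f u + ⟪ -T p ⟫ f   ≈⟨ +-cong (sym (-‿distribˡ-* _ _)) (⟪-T⟫ p f) ⟩
    - (a * f u) + - ⟪ p ⟫ f  ≈⟨ -‿+-comm _ _ ⟩
    - (a * f u + ⟪ p ⟫ f)    ∎

  -- g stands for the anonymous function inside _*T_, which can only be referred to through
  -- its defining equation.
  ⟪map⟫ : ∀ (g : K × Word → K × Word) {a u} → (∀ b v → g (b , v) ≡ (a * b , u ++ v)) →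
          ∀ q f → ⟪ map g q ⟫ f ≈ a * ⟪ q ⟫ (λ v → f (u ++ v))
  ⟪map⟫ g {a} {u} g≡ []            f = sym (zeroʳ a)
  ⟪map⟫ g {a} {u} g≡ ((b , v) ∷ q) f rewrite g≡ b v = begin
    a * b * f (u ++ v) + ⟪ map g q ⟫ f                        ≈⟨ +-cong (*-assoc _ _ _) (⟪map⟫ g g≡ q f) ⟩
    a * (b * f (u ++ v)) + a * ⟪ q ⟫ (λ v → f (u ++ v))       ≈⟨ distribˡ _ _ _ ⟨
    a * (b * f (u ++ v) + ⟪ q ⟫ (λ v → f (u ++ v)))           ∎

  ⟪*T⟫ : ∀ p q f → ⟪ p *T q ⟫ f ≈ ⟪ p ⟫ (λ u → ⟪ q ⟫ (λ v → f (u ++ v)))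
  ⟪*T⟫ []            q f = refl
  ⟪*T⟫ ((a , u) ∷ p) q f =
    trans (⟪+T⟫ (map _ q) (p *T q) f) (+-cong (⟪map⟫ _ (λ _ _ → ≡.refl) q f) (⟪*T⟫ p q f))

  ⟪1T⟫ : ∀ f → ⟪ 1T ⟫ f ≈ f []
  ⟪1T⟫ f = trans (+-identityʳ _) (*-identityˡ _)

  T-ring : Ring c (c ⊔ ℓ)
  T-ring = record
    { Carrier = T ; _≈_ = _≃_ ; _+_ = _+T_ ; _*_ = _*T_ ; -_ = -T_ ; 0# = 0T ; 1# = 1T
    ; isRing = record
      { +-isAbelianGroup = record
        { isGroup = record
          { isMonoid = record
            { isSemigroup = record
              { isMagma = record { isEquivalence = ≃-isEquivalence ; ∙-cong = +T-cong }
              ; assoc = λ p q r → mk≃ λ f → reflexive (≡.cong (λ s → ⟪ s ⟫ f) (++-assoc p q r))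
              }
            ; identity = (λ p → mk≃ λ f → refl)
                       , (λ p → mk≃ λ f → reflexive (≡.cong (λ s → ⟪ s ⟫ f) (++-identityʳ p)))
            }
          ; inverse = (λ p → mk≃ λ f → trans (⟪+T⟫ (-T p) p f) (trans (+-congʳ (⟪-T⟫ p f)) (-‿inverseˡ _)))
                    , (λ p → mk≃ λ f → trans (⟪+T⟫ p (-T p) f) (trans (+-congˡ (⟪-T⟫ p f)) (-‿inverseʳ _)))
          ; ⁻¹-cong = λ {p} {q} p≃q → mk≃ λ f →
              trans (⟪-T⟫ p f) (trans (-‿cong (eval p≃q f)) (sym (⟪-T⟫ q f)))
          }
        ; comm = λ p q → mk≃ λ f →
            trans (⟪+T⟫ p q f) (trans (+-comm _ _) (sym (⟪+T⟫ q p f)))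
        }
      ; *-cong = *T-cong
      ; *-assoc = *T-assoc
      ; *-identity = (λ p → mk≃ λ f → trans (⟪*T⟫ 1T p f) (⟪1T⟫ (λ u → ⟪ p ⟫ (λ v → f (u ++ v)))))
                   , (λ p → mk≃ λ f → trans (⟪*T⟫ p 1T f) (⟪⟫-congʳ p (λ u →
                       trans (⟪1T⟫ (λ v → f (u ++ v))) (reflexive (≡.cong f (++-identityʳ u))))))
      ; distrib = *T-distribˡ , *T-distribʳ
      }
    }
    where
    ≃-isEquivalence : IsEquivalence _≃_
    ≃-isEquivalence = record
      { refl  = mk≃ λ f → refl
      ; sym   = λ p≃q → mk≃ λ f → sym (eval p≃q f)
      ; trans = λ p≃q q≃r → mk≃ λ f → trans (eval p≃q f) (eval q≃r f)
      }

    +T-cong : ∀ {p p′ q q′} → p ≃ p′ → q ≃ q′ → p +T q ≃ p′ +T q′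
    +T-cong {p} {p′} {q} {q′} p≃p′ q≃q′ = mk≃ λ f → begin
      ⟪ p +T q ⟫ f         ≈⟨ ⟪+T⟫ p q f ⟩
      ⟪ p ⟫ f + ⟪ q ⟫ f    ≈⟨ +-cong (eval p≃p′ f) (eval q≃q′ f) ⟩
      ⟪ p′ ⟫ f + ⟪ q′ ⟫ f  ≈⟨ ⟪+T⟫ p′ q′ f ⟨
      ⟪ p′ +T q′ ⟫ f       ∎

    *T-cong : ∀ {p p′ q q′} → p ≃ p′ → q ≃ q′ → p *T q ≃ p′ *T q′
    *T-cong {p} {p′} {q} {q′} p≃p′ q≃q′ = mk≃ λ f → begin
      ⟪ p *T q ⟫ f                                     ≈⟨ ⟪*T⟫ p q f ⟩
      ⟪ p ⟫ (λ u → ⟪ q ⟫ (λ v → f (u ++ v)))           ≈⟨ ⟪⟫-congʳ p (λ u → eval q≃q′ _) ⟩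
      ⟪ p ⟫ (λ u → ⟪ q′ ⟫ (λ v → f (u ++ v)))          ≈⟨ eval p≃p′ _ ⟩
      ⟪ p′ ⟫ (λ u → ⟪ q′ ⟫ (λ v → f (u ++ v)))         ≈⟨ ⟪*T⟫ p′ q′ f ⟨
      ⟪ p′ *T q′ ⟫ f                                   ∎

    *T-assoc : ∀ p q r → (p *T q) *T r ≃ p *T (q *T r)
    *T-assoc p q r = mk≃ λ f → begin
      ⟪ (p *T q) *T r ⟫ f
        ≈⟨ trans (⟪*T⟫ (p *T q) r f) (⟪*T⟫ p q _) ⟩
      ⟪ p ⟫ (λ u → ⟪ q ⟫ (λ v → ⟪ r ⟫ (λ w → f ((u ++ v) ++ w))))
        ≈⟨ ⟪⟫-congʳ p (λ u → ⟪⟫-congʳ q (λ v → ⟪⟫-congʳ r (λ w → reflexive (≡.cong f (++-assoc u v w))))) ⟩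
      ⟪ p ⟫ (λ u → ⟪ q ⟫ (λ v → ⟪ r ⟫ (λ w → f (u ++ (v ++ w)))))
        ≈⟨ trans (⟪*T⟫ p (q *T r) f) (⟪⟫-congʳ p (λ u → ⟪*T⟫ q r _)) ⟨
      ⟪ p *T (q *T r) ⟫ f
        ∎

    *T-distribˡ : ∀ p q r → p *T (q +T r) ≃ (p *T q) +T (p *T r)
    *T-distribˡ p q r = mk≃ λ f → begin
      ⟪ p *T (q +T r) ⟫ f
        ≈⟨ trans (⟪*T⟫ p (q +T r) f) (⟪⟫-congʳ p (λ u → ⟪+T⟫ q r _)) ⟩
      ⟪ p ⟫ (λ u → ⟪ q ⟫ (λ v → f (u ++ v)) + ⟪ r ⟫ (λ v → f (u ++ v)))
        ≈⟨ ⟪⟫-+ʳ p _ _ ⟩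
      ⟪ p ⟫ (λ u → ⟪ q ⟫ (λ v → f (u ++ v))) + ⟪ p ⟫ (λ u → ⟪ r ⟫ (λ v → f (u ++ v)))
        ≈⟨ trans (⟪+T⟫ (p *T q) (p *T r) f) (+-cong (⟪*T⟫ p q f) (⟪*T⟫ p r f)) ⟨
      ⟪ (p *T q) +T (p *T r) ⟫ f
        ∎

    *T-distribʳ : ∀ p q r → (q +T r) *T p ≃ (q *T p) +T (r *T p)
    *T-distribʳ p q r = mk≃ λ f → begin
      ⟪ (q +T r) *T p ⟫ f
        ≈⟨ trans (⟪*T⟫ (q +T r) p f) (⟪+T⟫ q r _) ⟩
      ⟪ q ⟫ (λ u → ⟪ p ⟫ (λ v → f (u ++ v))) + ⟪ r ⟫ (λ u → ⟪ p ⟫ (λ v → f (u ++ v)))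
        ≈⟨ trans (⟪+T⟫ (q *T p) (r *T p) f) (+-cong (⟪*T⟫ q p f) (⟪*T⟫ r p f)) ⟨
      ⟪ (q *T p) +T (r *T p) ⟫ f
        ∎

  δ : Word → Word → K
  δ w u with ≡-dec _≟ℕ_ u w
  ... | yes _ = 1#
  ... | no  _ = 0#

  coeff≈⟪⟫δ : ∀ p w → coeff p w ≈ ⟪ p ⟫ (δ w)
  coeff≈⟪⟫δ []            w = refl
  coeff≈⟪⟫δ ((a , u) ∷ p) w with ≡-dec _≟ℕ_ u w
  ... | yes _ = +-cong (sym (*-identityʳ a)) (coeff≈⟪⟫δ p w)
  ... | no  _ = trans (coeff≈⟪⟫δ p w) (sym (trans (+-congʳ (zeroʳ a)) (+-identityˡ _)))

  ≃⇒≈T : ∀ {p q} → p ≃ q → p ≈T q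
  ≃⇒≈T {p} {q} p≃q w = trans (coeff≈⟪⟫δ p w) (trans (eval p≃q (δ w)) (sym (coeff≈⟪⟫δ q w)))

  remove : Word → T → T
  remove u []            = []
  remove u ((a , v) ∷ p) with ≡-dec _≟ℕ_ v u
  ... | yes _ = remove u p
  ... | no  _ = (a , v) ∷ remove u p

  remove-head : ∀ a u p → remove u ((a , u) ∷ p) ≡ remove u p
  remove-head a u p with ≡-dec _≟ℕ_ u u
  ... | yes _   = ≡.refl
  ... | no  u≢u = ⊥-elim (u≢u ≡.refl)

  length-remove : ∀ u p → length (remove u p) ≤ length p
  length-remove u []            = z≤n
  length-remove u ((a , v) ∷ p) with ≡-dec _≟ℕ_ v u
  ... | yes _ = m≤n⇒m≤1+n (length-remove u p)
  ... | no  _ = s≤s (length-remove u p)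

  ⟪⟫-remove : ∀ u p f → ⟪ p ⟫ f ≈ coeff p u * f u + ⟪ remove u p ⟫ f
  ⟪⟫-remove u []            f = sym (trans (+-congʳ (zeroˡ (f u))) (+-identityˡ 0#))
  ⟪⟫-remove u ((a , v) ∷ p) f with ≡-dec _≟ℕ_ v u
  ... | yes ≡.refl = begin
    a * f v + ⟪ p ⟫ f                                   ≈⟨ +-congˡ (⟪⟫-remove v p f) ⟩
    a * f v + (coeff p v * f v + ⟪ remove v p ⟫ f)      ≈⟨ +-assoc _ _ _ ⟨
    a * f v + coeff p v * f v + ⟪ remove v p ⟫ f        ≈⟨ +-congʳ (distribʳ (f v) a (coeff p v)) ⟨
    (a + coeff p v) * f v + ⟪ remove v p ⟫ f            ∎
  ... | no  _ = begin
    a * f v + ⟪ p ⟫ f                                   ≈⟨ +-congˡ (⟪⟫-remove u p f) ⟩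
    a * f v + (coeff p u * f u + ⟪ remove u p ⟫ f)      ≈⟨ x∙yz≈y∙xz _ _ _ ⟩
    coeff p u * f u + (a * f v + ⟪ remove u p ⟫ f)      ∎

  coefficients-vanish⇒≃0 : ∀ p → (∀ w → coeff p w ≈ 0#) → p ≃ 0T
  coefficients-vanish⇒≃0 p = bounded (length p) p ≤-refl
    where
    bounded : ∀ n p → length p ≤ n → (∀ w → coeff p w ≈ 0#) → p ≃ 0T
    bounded _       []            _           _       = mk≃ λ f → refl
    bounded (suc n) ((a , u) ∷ p) (s≤s len≤n) coeff≈0 = mk≃ λ f → begin
      ⟪ r ⟫ f                             ≈⟨ ⟪⟫-remove u r f ⟩
      coeff r u * f u + ⟪ remove u r ⟫ f
        ≈⟨ +-cong (*-congʳ (coeff≈0 u)) (eval (bounded n (remove u r) len′ coeff′≈0) f) ⟩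
      0# * f u + 0#                       ≈⟨ trans (+-identityʳ _) (zeroˡ _) ⟩
      0#                                  ∎
      where
      r : T
      r = (a , u) ∷ p
      len′ : length (remove u r) ≤ n
      len′ rewrite remove-head a u p = ≤-trans (length-remove u p) len≤n
      coeff′≈0 : ∀ w → coeff (remove u r) w ≈ 0#
      coeff′≈0 w = begin
        coeff (remove u r) w                        ≈⟨ coeff≈⟪⟫δ (remove u r) w ⟩
        ⟪ remove u r ⟫ (δ w)                        ≈⟨ +-identityˡ _ ⟨
        0# + ⟪ remove u r ⟫ (δ w)                   ≈⟨ +-congʳ (trans (*-congʳ (coeff≈0 u)) (zeroˡ _)) ⟨
        coeff r u * δ w u + ⟪ remove u r ⟫ (δ w)    ≈⟨ ⟪⟫-remove u r (δ w) ⟨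
        ⟪ r ⟫ (δ w)                                 ≈⟨ coeff≈⟪⟫δ r w ⟨
        coeff r w                                   ≈⟨ coeff≈0 w ⟩
        0#                                          ∎

  ≈T⇒≃ : ∀ {p q} → p ≈T q → p ≃ q
  ≈T⇒≃ {p} {q} p≈q =
    RingProperties.x∙y⁻¹≈ε⇒x≈y T-ring p q (coefficients-vanish⇒≃0 (p +T (-T q)) difference≈0)
    where
    difference≈0 : ∀ w → coeff (p +T (-T q)) w ≈ 0#
    difference≈0 w = begin
      coeff (p +T (-T q)) w              ≈⟨ coeff≈⟪⟫δ (p +T (-T q)) w ⟩
      ⟪ p +T (-T q) ⟫ (δ w)              ≈⟨ trans (⟪+T⟫ p (-T q) (δ w)) (+-congˡ (⟪-T⟫ q (δ w))) ⟩
      ⟪ p ⟫ (δ w) - ⟪ q ⟫ (δ w)          ≈⟨ +-cong (coeff≈⟪⟫δ p w) (-‿cong (coeff≈⟪⟫δ q w)) ⟨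
      coeff p w - coeff q w              ≈⟨ +-congʳ (p≈q w) ⟩
      coeff q w - coeff q w              ≈⟨ -‿inverseʳ _ ⟩
      0#                                 ∎

module SpitzerAntipode {c ℓ} (R : CommutativeRing c ℓ) where
  open Spitzer R
  open Evaluation R using (T-ring; ≈T⇒≃; ≃⇒≈T)
  open Ring T-ring hiding (zero)
  open RingProperties T-ring using (-‿+-comm)
  open Convolution T-ring
  open SetoidReasoning setoid

  antipode : ℕ → A
  antipode zero    = 1A
  antipode (suc n) = -A (ρ (𝕏 *A ρ̃Xpow n))

  ρ̃≈-ρ-suc : ∀ y k → ρ̃ y k ≈ - ρ y (suc k)
  ρ̃≈-ρ-suc y k = begin
    - y k + - partialSum y k  ≈⟨ -‿+-comm (y k) (partialSum y k) ⟩
    - (y k + partialSum y k)  ≈⟨ -‿cong (+-comm (y k) (partialSum y k)) ⟩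
    - (partialSum y k + y k)  ∎

  ρ̃Xpow≈antipode-suc : ∀ m k → ρ̃Xpow m k ≈ antipode m (suc k)
  ρ̃Xpow≈antipode-suc zero    k = refl
  ρ̃Xpow≈antipode-suc (suc m) k = ρ̃≈-ρ-suc (𝕏 *A ρ̃Xpow m) k

  antipode-recurrence : ∀ m k → antipode (suc m) (suc k) + var k * antipode m (suc k) ≈ antipode (suc m) k
  antipode-recurrence m k = begin
    - (partialSum Y k + Y k) + var k * antipode m (suc k)
      ≈⟨ +-cong (sym (-‿+-comm (partialSum Y k) (Y k))) (*-congˡ {var k} (sym (ρ̃Xpow≈antipode-suc m k))) ⟩
    (- partialSum Y k + - Y k) + Y k                       ≈⟨ +-assoc (- partialSum Y k) (- Y k) (Y k) ⟩
    - partialSum Y k + (- Y k + Y k)                       ≈⟨ +-congˡ (-‿inverseˡ (Y k)) ⟩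
    - partialSum Y k + 0#                                  ≈⟨ +-identityʳ _ ⟩
    - partialSum Y k                                       ∎
    where
    Y : A
    Y = 𝕏 *A ρ̃Xpow m

  antipode-conv : ℕ → ℕ → T
  antipode-conv k = conv (λ m → ρXpow m k) (λ m → antipode m k)

  -- (ρX)^[m+1] (k+1) = (ρX)^[m+1] k + (ρX)^[m] k · x_k holds by computation.
  antipode-conv-suc : ∀ k N → antipode-conv (suc k) N ≈ antipode-conv k N
  antipode-conv-suc k N =
    trans (conv-telescope (var k) refl (λ m → antipode-recurrence m k)
                          N (λ m → ρXpow m k) (λ m → ρXpow m (suc k)) 0# refl (λ m → refl))
          (+-identityʳ _)

  -- ρ y 0 = 0T, so (ρX)^[m+1] and antipode (m+1) vanish in component 0 by computation.
  antipode-conv-zero : ∀ n → antipode-conv zero (suc n) ≈ 0#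
  antipode-conv-zero n = trans (+-cong (zeroʳ 1#) (conv-zeroˡ _ n (λ m → refl))) (+-identityʳ 0#)

  antipode-right-inverse : ∀ k n → antipode-conv k (suc n) ≈ 0#
  antipode-right-inverse zero    n = antipode-conv-zero n
  antipode-right-inverse (suc k) n = trans (antipode-conv-suc k (suc n)) (antipode-right-inverse k n)

  sumTo-peel : ∀ N (g : ℕ → A) k → sumTo (suc N) g k ≈ g zero k + sumTo N (g ∘ suc) k
  sumTo-peel zero    g k = refl
  sumTo-peel (suc N) g k =
    trans (+-congʳ (sumTo-peel N g k)) (+-assoc (g zero k) (sumTo N (g ∘ suc) k) (g (suc (suc N)) k))

  sumTo≈conv : ∀ N (α β : ℕ → A) k →
               sumTo N (λ m → α m *A β (N ∸ m)) k ≈ conv (λ m → α m k) (λ m → β m k) N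
  sumTo≈conv zero    α β k = refl
  sumTo≈conv (suc N) α β k =
    trans (sumTo-peel N (λ m → α m *A β (suc N ∸ m)) k) (+-congˡ (sumTo≈conv N (α ∘ suc) β k))

  antipode-unique : ∀ s → IsAntipodeOnGenerators s → ∀ n → s n ≈A antipode n
  antipode-unique s isAntipode n k =
    ≃⇒≈T (conv-rightInverse-unique (λ m → ρXpow m k) refl (≈T⇒≃ (unit k))
                                   s-right-inverse (antipode-right-inverse k) n)
    where
    open IsAntipodeOnGenerators isAntipode
    s-right-inverse : ∀ n → conv (λ m → ρXpow m k) (λ m → s m k) (suc n) ≈ 0#
    s-right-inverse n = trans (sym (sumTo≈conv (suc n) ρXpow s k)) (≈T⇒≃ (right n k))

mainTheorem6 : {c ℓ : Level} (F : CharZeroField c ℓ) →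
    let open Spitzer (CharZeroField.commutativeRing F) in
    (s : ℕ → A) → IsAntipodeOnGenerators s →
    (n : ℕ) → s (suc n) ≈A (-A (ρ (𝕏 *A ρ̃Xpow n)))
mainTheorem6 F s isAntipode n =
  SpitzerAntipode.antipode-unique (CharZeroField.commutativeRing F) s isAntipode (suc n)
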